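{- For grid graphs, \[ \mathrm{nim}(\mathrm{DNG}(P_{m}\square P_{n}))=\begin{cases} 0,& m=2 \\ 2\,\mathrm{pty}(m+n), & m\ge 3. \end{cases} \]
   Context: A grid graph is the box (Cartesian) product $P_m\square P_n$ of path graphs with $2\le m\le n$ and $3\le n$. For a graph $G=(V,E)$, a set of vertices is geodetically convex if it contains every vertex on every shortest path between two of its vertices; the convex hull $[P]$ is the smallest convex set containing $P$, and $P$ is generating if $[P]=V$. In the avoidance game $\mathrm{DNG}(G)$, two players alternately select previously-unselected vertices such that the selected set never generates; the player who cannot move loses. $\mathrm{nim}$ denotes the nim-number of an impartial game, and $\mathrm{pty}(k):=k\bmod 2$. -}

module Defs where

open import Level using (Level; 0ℓ; Lift) renaming (suc to lsuc)
open import Data.Nat using (ℕ; zero; suc; _+_; _*_; _∸_; _<_; _≤_)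
open import Data.Fin using (Fin; toℕ)
open import Data.Product using (Σ; ∃; ∃-syntax; _×_; _,_)
open import Data.Sum using (_⊎_)
open import Data.List using (List; []; _∷_; length)
open import Data.List.Membership.Propositional using (_∈_; _∉_)
open import Relation.Nullary using (¬_)
open import Relation.Binary.PropositionalEquality using (_≡_; _≢_)

record Graph : Set₁ where
  field
    V   : Set
    Adj : V → V → Set
    order : ℕ            -- number of vertices |V|

open Graph public

data Walk (G : Graph) : V G → V G → ℕ → Set where
  nil  : ∀ {u} → Walk G u u 0
  cons : ∀ {u w v k} → Adj G u w → Walk G w v k → Walk G u v (suc k)

OnGeodesic : (G : Graph) → V G → V G → V G → Set
OnGeodesic G u v z =
  ∃[ a ] ∃[ b ] (Walk G u z a × Walk G z v b × (∀ k → Walk G u v k → a + b ≤ k))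

Convex : (G : Graph) → (V G → Set) → Set
Convex G C = ∀ u v z → C u → C v → OnGeodesic G u v z → C z

-- P is generating: the convex hull [P] (the smallest convex set containing P,
-- i.e. the intersection of all convex supersets of P) is all of V
Generating : (G : Graph) → List (V G) → Set₁
Generating G P = ∀ (C : V G → Set) → Convex G C → (∀ x → x ∈ P → C x) → ∀ v → C v

-- The avoidance game DNG(G): positions are lists of selected vertices.
-- A move from P selects an unselected vertex v with v ∷ P non-generating.

Move : (G : Graph) → List (V G) → V G → Set₁
Move G P v = (v ∉ P) × ¬ Generating G (v ∷ P)

-- NimAt G r P g : the position P, which has r unselected vertices
-- (r = |V| - |P|), has nim-number (Grundy value) g, i.e.
-- g = mex { nim(v ∷ P) | v a legal move }.  Defined by recursion on r.
NimAt : (G : Graph) → ℕ → List (V G) → ℕ → Set₁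
NimAt G zero    P g = Lift (lsuc 0ℓ) (g ≡ 0)
NimAt G (suc r) P g =
  (∀ j → j < g → ∃[ v ] (Move G P v × NimAt G r (v ∷ P) j)) ×
  (∀ v → Move G P v → ∀ j → NimAt G r (v ∷ P) j → j ≢ g)

NimDNG : Graph → ℕ → Set₁
NimDNG G g = NimAt G (order G) [] g

PathAdj : (m : ℕ) → Fin m → Fin m → Set
PathAdj m a b = (suc (toℕ a) ≡ toℕ b) ⊎ (suc (toℕ b) ≡ toℕ a)

Grid : ℕ → ℕ → Graph
Grid m n = record
  { V     = Fin m × Fin n
  ; Adj   = λ { (a , b) (a' , b') →
               (a ≡ a' × PathAdj n b b') ⊎ (PathAdj m a a' × b ≡ b') }
  ; order = m * n
  }

-- A vertex set of the grid generates it exactly when it meets all four sides (first and last row,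
-- first and last column): the vertices off one side form a convex set, while from vertices on all
-- four sides every vertex is reached by shortest paths between points already in the hull.  So a
-- position P of the game matters only through the set S of sides it meets and the parity of |P|.
-- A move either meets a new side, and a vertex with any side set occurring in the grid is then
-- available, or keeps S by selecting a vertex of the region of vertices whose sides lie in S.
-- Since P lies in that region, the latter is possible whenever |P| and the region size
-- (m − 2 + #{top, bottom} ∩ S) (n − 2 + #{left, right} ∩ S) differ in parity.  Hence the nim-number
-- of P is a function of S, |P| mod 2, whether m = 2, and the parities of m and n, and that an
-- explicit such function satisfies the mex recursion is a finite check carried out by evaluation.

module Submission where

open import Defs
open import Data.Nat using (ℕ; _+_; _*_; _≤_; _%_)
open import Data.Product using (_×_)
open import Relation.Binary.PropositionalEquality using (_≡_)

open import Data.Bool using (Bool; true; false; _∧_; _∨_; not; T; if_then_else_)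
open import Data.Bool.Properties
  using (T-∧; T-∨; T-≡; T-not-≡; ∨-conicalˡ; ∨-conicalʳ; ∨-zeroʳ; ∧-conicalˡ; ∧-conicalʳ)
open import Data.Empty using (⊥-elim)
open import Data.Fin using (Fin; toℕ; fromℕ; inject₁) renaming (zero to fzero; suc to fsuc)
import Data.Fin as Fin
open import Data.Fin.Properties using (toℕ<n; inject₁-injective) renaming (suc-injective to fsuc-injective)
open import Data.List using (List; []; _∷_; length; map; _++_; foldr; allFin; cartesianProduct)
open import Data.List.Properties using (length-removeAt′; length-++; length-map; length-tabulate)
open import Data.List.Membership.Propositional using (_∈_; _∉_; find)
open import Data.List.Membership.Propositional.Properties
  using (∈-map⁺; ∈-map⁻; ∈-allFin; ∈-cartesianProduct⁺; ∈-cartesianProduct⁻)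
open import Data.List.Relation.Unary.Any using (here; there; _─_)
import Data.List.Relation.Unary.All as All
open import Data.List.Relation.Unary.All.Properties using (¬All⇒Any¬)
open import Data.List.Relation.Unary.AllPairs using ([]; _∷_)
open import Data.List.Relation.Unary.Unique.Propositional using (Unique)
import Data.List.Relation.Unary.Unique.Propositional.Properties as Unique
open import Data.Nat
  using (zero; suc; _⊔_; _<_; _≡ᵇ_; z≤n; s≤s; s≤s⁻¹; ∣_-_∣; compare; less; equal; greater; parity)
open import Data.Nat.Properties
open import Algebra.Properties.CommutativeSemigroup +-commutativeSemigroup using (interchange)
open import Data.Parity using (Parity; 0ℙ; 1ℙ; _⁻¹) renaming (_+_ to _+ᵖ_; _*_ to _*ᵖ_)
import Data.Parity.Properties as ℙ
open import Data.Product using (∃-syntax; _,_; proj₁; proj₂)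
open import Data.Product.Properties using (≡-dec)
open import Data.Sum using (_⊎_; inj₁; inj₂)
open import Function using (id; _∘_)
open import Function.Bundles using (Equivalence)
open import Level using (lift)
open import Relation.Binary.Definitions using (DecidableEquality; tri<; tri≈; tri>)
open import Relation.Binary.PropositionalEquality
open import Relation.Nullary using (¬_; yes; no)

module _ {A : Set} where

  ∈-─ : ∀ {x y : A} {xs} (x∈xs : x ∈ xs) → y ∈ xs → y ≢ x → y ∈ (xs ─ x∈xs)
  ∈-─ (here refl) (here refl)  y≢x = ⊥-elim (y≢x refl)
  ∈-─ (here refl) (there y∈xs) y≢x = y∈xs
  ∈-─ (there x∈xs) (here refl)  y≢x = here refl
  ∈-─ (there x∈xs) (there y∈xs) y≢x = there (∈-─ x∈xs y∈xs y≢x)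

  ∷-unique : ∀ {x : A} {xs} → x ∉ xs → Unique xs → Unique (x ∷ xs)
  ∷-unique x∉xs xs! = All.tabulate (λ y∈xs x≡y → x∉xs (subst (_∈ _) (sym x≡y) y∈xs)) ∷ xs!

  unique-⊆⇒length-≤ : ∀ {xs ys : List A} → Unique xs → (∀ {x} → x ∈ xs → x ∈ ys) →
                      length xs ≤ length ys
  unique-⊆⇒length-≤ {[]}     _           _  = z≤n
  unique-⊆⇒length-≤ {x ∷ xs} {ys} (x∉xs ∷ xs!) xs⊆ys = ≤-trans
    (s≤s (unique-⊆⇒length-≤ xs! λ y∈xs →
      ∈-─ x∈ys (xs⊆ys (there y∈xs)) λ { refl → All.lookup x∉xs y∈xs refl }))
    (≤-reflexive (sym (length-removeAt′ ys _)))
    where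
    x∈ys : x ∈ ys
    x∈ys = xs⊆ys (here refl)

  module _ (_≟_ : DecidableEquality A) where
    open import Data.List.Membership.DecPropositional _≟_ using (_∈?_)

    longer⇒∃∉ : ∀ {xs ys : List A} → Unique ys → length xs < length ys → ∃[ y ] (y ∈ ys × y ∉ xs)
    longer⇒∃∉ {xs} {ys} ys! xs<ys with All.all? (_∈? xs) ys
    ... | yes ys⊆xs = ⊥-elim (<⇒≱ xs<ys (unique-⊆⇒length-≤ ys! (All.lookup ys⊆xs)))
    ... | no ys⊈xs = find (¬All⇒Any¬ (_∈? xs) ys ys⊈xs)

length-cartesianProduct : ∀ {A B : Set} (xs : List A) (ys : List B) →
                          length (cartesianProduct xs ys) ≡ length xs * length ys
length-cartesianProduct []       ys = refl
length-cartesianProduct (x ∷ xs) ys = begin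
  length (map (x ,_) ys ++ cartesianProduct xs ys)
    ≡⟨ length-++ (map (x ,_) ys) ⟩
  length (map (x ,_) ys) + length (cartesianProduct xs ys)
    ≡⟨ cong₂ _+_ (length-map (x ,_) ys) (length-cartesianProduct xs ys) ⟩
  length ys + length xs * length ys
    ∎
  where open ≡-Reasoning

length-allFin : ∀ n → length (allFin n) ≡ n
length-allFin n = length-tabulate {n = n} id

-- Nim-numbers of mex labellings

module _ {G : Graph} where

  nimAt-unique : ∀ r {P g h} → NimAt G r P g → NimAt G r P h → g ≡ h
  nimAt-unique zero    (lift g≡0) (lift h≡0) = trans g≡0 (sym h≡0)
  nimAt-unique (suc r) {g = g} {h} (g-reach , g-avoid) (h-reach , h-avoid) with <-cmp g h
  ... | tri≈ _ g≡h _ = g≡h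
  ... | tri< g<h _ _ = let v , move , v-g = h-reach g g<h in ⊥-elim (g-avoid v move g v-g refl)
  ... | tri> _ _ h<g = let v , move , v-h = g-reach h h<g in ⊥-elim (h-avoid v move h v-h refl)

record Position (G : Graph) (r : ℕ) (P : List (V G)) : Set₁ where
  field
    distinct      : Unique P
    nonGenerating : ¬ Generating G P
    unselected    : r + length P ≡ order G

module _ {G : Graph} where

  Position-move : ∀ {r P v} → Position G (suc r) P → Move G P v → Position G r (v ∷ P)
  Position-move {r} {P} pos (v∉P , nonGen) = record
    { distinct      = ∷-unique v∉P (Position.distinct pos)
    ; nonGenerating = nonGen
    ; unselected    = trans (+-suc r (length P)) (Position.unselected pos)
    }

record MexLabelling (G : Graph) (value : List (V G) → ℕ) : Set₁ where
  field
    terminal : ∀ {P} → Position G 0 P → value P ≡ 0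
    reach    : ∀ {r P} → Position G (suc r) P → ∀ j → j < value P →
               ∃[ v ] (Move G P v × value (v ∷ P) ≡ j)
    escape   : ∀ {r P v} → Position G (suc r) P → Move G P v → value (v ∷ P) ≢ value P

module _ {G : Graph} {value : List (V G) → ℕ} (labelling : MexLabelling G value) where
  open MexLabelling labelling

  nimAt-labelling : ∀ r {P} → Position G r P → NimAt G r P (value P)
  nimAt-labelling zero    pos = lift (terminal pos)
  nimAt-labelling (suc r) {P} pos = options-below , no-option-equal
    where
    nimAt-option : ∀ {v} (move : Move G P v) → NimAt G r (v ∷ P) (value (v ∷ P))
    nimAt-option move = nimAt-labelling r (Position-move pos move)

    options-below : ∀ j → j < value P → ∃[ v ] (Move G P v × NimAt G r (v ∷ P) j)
    options-below j j<value with reach pos j j<value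
    ... | v , move , refl = v , move , nimAt-option move

    no-option-equal : ∀ v → Move G P v → ∀ j → NimAt G r (v ∷ P) j → j ≢ value P
    no-option-equal v move j nim-j refl =
      escape pos move (nimAt-unique r (nimAt-option move) nim-j)

-- Shortest paths in grids

module _ {G : Graph} where

  walk-++ : ∀ {u w v a b} → Walk G u w a → Walk G w v b → Walk G u v (a + b)
  walk-++ nil        q = q
  walk-++ (cons e p) q = cons e (walk-++ p q)

  walk-reverse : (∀ {x y} → Adj G x y → Adj G y x) → ∀ {u v k} → Walk G u v k → Walk G v u k
  walk-reverse adj-sym nil = nil
  walk-reverse adj-sym {k = suc k} (cons e p) =
    subst (Walk G _ _) (+-comm k 1) (walk-++ (walk-reverse adj-sym p) (cons (adj-sym e) nil))

walk-map : ∀ {G H : Graph} (f : V G → V H) → (∀ {x y} → Adj G x y → Adj H (f x) (f y)) →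
           ∀ {u v k} → Walk G u v k → Walk H (f u) (f v) k
walk-map f f-adj nil        = nil
walk-map f f-adj (cons e p) = cons (f-adj e) (walk-map f f-adj p)

Path : ℕ → Graph
Path k = record { V = Fin k ; Adj = PathAdj k ; order = k }

pathAdj-sym : ∀ {k} {x y : Fin k} → PathAdj k x y → PathAdj k y x
pathAdj-sym (inj₁ e) = inj₂ e
pathAdj-sym (inj₂ e) = inj₁ e

pathWalk-suc : ∀ {k} {x y : Fin k} {d} → Walk (Path k) x y d → Walk (Path (suc k)) (fsuc x) (fsuc y) d
pathWalk-suc = walk-map {Path _} fsuc λ { (inj₁ e) → inj₁ (cong suc e) ; (inj₂ e) → inj₂ (cong suc e) }

pathWalk-from₀ : ∀ {k} (y : Fin (suc k)) → Walk (Path (suc k)) fzero y (toℕ y)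
pathWalk-from₀ fzero = nil
pathWalk-from₀ {suc k} (fsuc y) = cons (inj₁ refl) (pathWalk-suc (pathWalk-from₀ y))

pathWalk : ∀ {k} (x y : Fin k) → Walk (Path k) x y ∣ toℕ x - toℕ y ∣
pathWalk fzero    y        = pathWalk-from₀ y
pathWalk (fsuc x) fzero    = walk-reverse pathAdj-sym (pathWalk-from₀ (fsuc x))
pathWalk (fsuc x) (fsuc y) = pathWalk-suc (pathWalk x y)

∣n-suc-n∣≡1 : ∀ n → ∣ n - suc n ∣ ≡ 1
∣n-suc-n∣≡1 zero    = refl
∣n-suc-n∣≡1 (suc n) = ∣n-suc-n∣≡1 n

pathAdj⇒∣-∣≡1 : ∀ {k} {x y : Fin k} → PathAdj k x y → ∣ toℕ x - toℕ y ∣ ≡ 1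
pathAdj⇒∣-∣≡1 {x = x} (inj₁ e) = subst (λ t → ∣ toℕ x - t ∣ ≡ 1) e (∣n-suc-n∣≡1 (toℕ x))
pathAdj⇒∣-∣≡1 {y = y} (inj₂ e) =
  subst (λ t → ∣ t - toℕ y ∣ ≡ 1) e (trans (∣-∣-comm (suc (toℕ y)) (toℕ y)) (∣n-suc-n∣≡1 (toℕ y)))

pathAdj-∣-∣-≤ : ∀ {k} {x y : Fin k} z → PathAdj k x y → ∣ toℕ x - z ∣ ≤ suc ∣ toℕ y - z ∣
pathAdj-∣-∣-≤ {x = x} {y} z e = begin
  ∣ toℕ x - z ∣                        ≤⟨ ∣-∣-triangle (toℕ x) (toℕ y) z ⟩
  ∣ toℕ x - toℕ y ∣ + ∣ toℕ y - z ∣    ≡⟨ cong (_+ ∣ toℕ y - z ∣) (pathAdj⇒∣-∣≡1 e) ⟩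
  suc ∣ toℕ y - z ∣                    ∎
  where open ≤-Reasoning

o<m⇒o<n⇒∣m-n∣<∣m-o∣+∣o-n∣ : ∀ {m n o} → o < m → o < n → ∣ m - n ∣ < ∣ m - o ∣ + ∣ o - n ∣
o<m⇒o<n⇒∣m-n∣<∣m-o∣+∣o-n∣ {suc m} {suc n} {zero} _ _ = s≤s (begin
  ∣ m - n ∣   ≤⟨ ∣m-n∣≤m⊔n m n ⟩
  m ⊔ n       ≤⟨ m⊔n≤m+n m n ⟩
  m + n       ≤⟨ +-monoʳ-≤ m (n≤1+n n) ⟩
  m + suc n   ∎)
  where open ≤-Reasoning
o<m⇒o<n⇒∣m-n∣<∣m-o∣+∣o-n∣ {suc m} {suc n} {suc o} (s≤s o<m) (s≤s o<n) =
  o<m⇒o<n⇒∣m-n∣<∣m-o∣+∣o-n∣ o<m o<n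

m<o⇒n<o⇒∣m-n∣<∣m-o∣+∣o-n∣ : ∀ {m n o} → m < o → n < o → ∣ m - n ∣ < ∣ m - o ∣ + ∣ o - n ∣
m<o⇒n<o⇒∣m-n∣<∣m-o∣+∣o-n∣ {zero} {n} {o} _ n<o = ≤-trans n<o (m≤m+n o ∣ o - n ∣)
m<o⇒n<o⇒∣m-n∣<∣m-o∣+∣o-n∣ {suc m} {zero} {o} m<o _ = begin-strict
  suc m                    <⟨ m<o ⟩
  o                        ≤⟨ m≤n+m o ∣ suc m - o ∣ ⟩
  ∣ suc m - o ∣ + o        ≡⟨ cong (∣ suc m - o ∣ +_) (∣-∣-identityʳ o) ⟨
  ∣ suc m - o ∣ + ∣ o - 0 ∣ ∎
  where open ≤-Reasoning
m<o⇒n<o⇒∣m-n∣<∣m-o∣+∣o-n∣ {suc m} {suc n} {suc o} (s≤s m<o) (s≤s n<o) =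
  m<o⇒n<o⇒∣m-n∣<∣m-o∣+∣o-n∣ m<o n<o

Between : ℕ → ℕ → ℕ → Set
Between m n o = ∣ m - n ∣ + ∣ n - o ∣ ≡ ∣ m - o ∣

≤-between : ∀ {m n o} → m ≤ n → n ≤ o → Between m n o
≤-between {zero} {n} {o} _ n≤o = trans (cong (n +_) (m≤n⇒∣m-n∣≡n∸m n≤o)) (m+[n∸m]≡n n≤o)
≤-between (s≤s m≤n) (s≤s n≤o) = ≤-between m≤n n≤o

between-leftEnd : ∀ m o → Between m m o
between-leftEnd m o = cong (_+ ∣ m - o ∣) (∣n-n∣≡0 m)

between-rightEnd : ∀ m o → Between m o o
between-rightEnd m o = trans (cong (∣ m - o ∣ +_) (∣n-n∣≡0 o)) (+-identityʳ ∣ m - o ∣)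

module GridGeometry (m n : ℕ) where

  Vertex : Set
  Vertex = Fin m × Fin n

  dist : Vertex → Vertex → ℕ
  dist (i , j) (i′ , j′) = ∣ toℕ i - toℕ i′ ∣ + ∣ toℕ j - toℕ j′ ∣

  gridWalk : ∀ u v → Walk (Grid m n) u v (dist u v)
  gridWalk (i , j) (i′ , j′) = walk-++
    (walk-map {Path m} (_, j) (λ e → inj₂ (e , refl)) (pathWalk i i′))
    (walk-map {Path n} (i′ ,_) (λ e → inj₁ (refl , e)) (pathWalk j j′))

  dist-adj : ∀ {u w} v → Adj (Grid m n) u w → dist u v ≤ suc (dist w v)
  dist-adj {i , j} {_ , j′} (i″ , j″) (inj₁ (refl , e)) = begin
    ∣ toℕ i - toℕ i″ ∣ + ∣ toℕ j - toℕ j″ ∣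
      ≤⟨ +-monoʳ-≤ ∣ toℕ i - toℕ i″ ∣ (pathAdj-∣-∣-≤ (toℕ j″) e) ⟩
    ∣ toℕ i - toℕ i″ ∣ + suc ∣ toℕ j′ - toℕ j″ ∣
      ≡⟨ +-suc _ _ ⟩
    suc (∣ toℕ i - toℕ i″ ∣ + ∣ toℕ j′ - toℕ j″ ∣)
      ∎
    where open ≤-Reasoning
  dist-adj {_ , j} (i″ , j″) (inj₂ (e , refl)) =
    +-monoˡ-≤ ∣ toℕ j - toℕ j″ ∣ (pathAdj-∣-∣-≤ (toℕ i″) e)

  dist≤length : ∀ {u v k} → Walk (Grid m n) u v k → dist u v ≤ k
  dist≤length {i , j} nil = ≤-reflexive (cong₂ _+_ (∣n-n∣≡0 (toℕ i)) (∣n-n∣≡0 (toℕ j)))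
  dist≤length {v = v} (cons e p) = ≤-trans (dist-adj v e) (s≤s (dist≤length p))

  onGeodesic⇒dist : ∀ {u v z} → OnGeodesic (Grid m n) u v z → dist u z + dist z v ≤ dist u v
  onGeodesic⇒dist {u} {v} (_ , _ , p , q , shortest) =
    ≤-trans (+-mono-≤ (dist≤length p) (dist≤length q)) (shortest (dist u v) (gridWalk u v))

  dist⇒onGeodesic : ∀ {u v z} → dist u z + dist z v ≤ dist u v → OnGeodesic (Grid m n) u v z
  dist⇒onGeodesic {u} {v} {z} between =
    dist u z , dist z v , gridWalk u z , gridWalk z v , λ k w → ≤-trans between (dist≤length w)

  dist-via : ∀ (u z v : Vertex) → let (i , j) = u ; (i″ , j″) = z ; (i′ , j′) = v in
             dist u z + dist z v ≡
             (∣ toℕ i - toℕ i″ ∣ + ∣ toℕ i″ - toℕ i′ ∣) + (∣ toℕ j - toℕ j″ ∣ + ∣ toℕ j″ - toℕ j′ ∣)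
  dist-via (i , j) (i″ , j″) (i′ , j′) =
    interchange ∣ toℕ i - toℕ i″ ∣ ∣ toℕ j - toℕ j″ ∣ ∣ toℕ i″ - toℕ i′ ∣ ∣ toℕ j″ - toℕ j′ ∣

  rowDetour⇒detour : ∀ (u v z : Vertex) → let (i , _) = u ; (i′ , _) = v ; (i″ , _) = z in
                     ∣ toℕ i - toℕ i′ ∣ < ∣ toℕ i - toℕ i″ ∣ + ∣ toℕ i″ - toℕ i′ ∣ →
                     dist u v < dist u z + dist z v
  rowDetour⇒detour u@(_ , j) v@(_ , j′) z@(_ , j″) rows = subst (dist u v <_) (sym (dist-via u z v))
    (+-mono-<-≤ rows (∣-∣-triangle (toℕ j) (toℕ j″) (toℕ j′)))

  colDetour⇒detour : ∀ (u v z : Vertex) → let (_ , j) = u ; (_ , j′) = v ; (_ , j″) = z in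
                     ∣ toℕ j - toℕ j′ ∣ < ∣ toℕ j - toℕ j″ ∣ + ∣ toℕ j″ - toℕ j′ ∣ →
                     dist u v < dist u z + dist z v
  colDetour⇒detour u@(i , _) v@(i′ , _) z@(i″ , _) cols = subst (dist u v <_) (sym (dist-via u z v))
    (+-mono-≤-< (∣-∣-triangle (toℕ i) (toℕ i″) (toℕ i′)) cols)

  dist-between : ∀ (u z v : Vertex) → let (i , j) = u ; (i″ , j″) = z ; (i′ , j′) = v in
                 Between (toℕ i) (toℕ i″) (toℕ i′) → Between (toℕ j) (toℕ j″) (toℕ j′) →
                 dist u z + dist z v ≡ dist u v
  dist-between u z v rows cols = trans (dist-via u z v) (cong₂ _+_ rows cols)

  between⇒onGeodesic : ∀ (u z v : Vertex) → let (i , j) = u ; (i″ , j″) = z ; (i′ , j′) = v in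
                       Between (toℕ i) (toℕ i″) (toℕ i′) → Between (toℕ j) (toℕ j″) (toℕ j′) →
                       OnGeodesic (Grid m n) u v z
  between⇒onGeodesic u z v rows cols = dist⇒onGeodesic (≤-reflexive (dist-between u z v rows cols))

-- Sides and generating sets

data Side : Set where
  top bottom left right : Side

record Sides : Set where
  constructor sides
  field
    onTop onBottom onLeft onRight : Bool

_‼_ : Sides → Side → Bool
sides t _ _ _ ‼ top    = t
sides _ b _ _ ‼ bottom = b
sides _ _ l _ ‼ left   = l
sides _ _ _ r ‼ right  = r

none : Sides
none = sides false false false false

_∪_ : Sides → Sides → Sides
sides t b l r ∪ sides t′ b′ l′ r′ = sides (t ∨ t′) (b ∨ b′) (l ∨ l′) (r ∨ r′)

complete : Sides → Bool
complete (sides t b l r) = t ∧ b ∧ l ∧ r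

‼-∪ : ∀ K S X → (K ∪ S) ‼ X ≡ K ‼ X ∨ S ‼ X
‼-∪ (sides _ _ _ _) (sides _ _ _ _) top    = refl
‼-∪ (sides _ _ _ _) (sides _ _ _ _) bottom = refl
‼-∪ (sides _ _ _ _) (sides _ _ _ _) left   = refl
‼-∪ (sides _ _ _ _) (sides _ _ _ _) right  = refl

incomplete⇒missing : ∀ S → complete S ≡ false → ∃[ X ] (S ‼ X ≡ false)
incomplete⇒missing (sides false _     _     _    ) _ = top , refl
incomplete⇒missing (sides true  false _     _    ) _ = bottom , refl
incomplete⇒missing (sides true  true  false _    ) _ = left , refl
incomplete⇒missing (sides true  true  true  false) _ = right , refl

complete⇒‼ : ∀ S → complete S ≡ true → ∀ X → S ‼ X ≡ true
complete⇒‼ (sides true true true true) _ top    = refl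
complete⇒‼ (sides true true true true) _ bottom = refl
complete⇒‼ (sides true true true true) _ left   = refl
complete⇒‼ (sides true true true true) _ right  = refl

_⇒ˢ_ : Sides → Sides → Sides
sides t b l r ⇒ˢ sides t′ b′ l′ r′ = sides (not t ∨ t′) (not b ∨ b′) (not l ∨ l′) (not r ∨ r′)

‼-⇒ˢ : ∀ K S X → (K ⇒ˢ S) ‼ X ≡ not (K ‼ X) ∨ S ‼ X
‼-⇒ˢ (sides _ _ _ _) (sides _ _ _ _) top    = refl
‼-⇒ˢ (sides _ _ _ _) (sides _ _ _ _) bottom = refl
‼-⇒ˢ (sides _ _ _ _) (sides _ _ _ _) left   = refl
‼-⇒ˢ (sides _ _ _ _) (sides _ _ _ _) right  = refl

_⊆ᵇ_ : Sides → Sides → Bool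
K ⊆ᵇ S = complete (K ⇒ˢ S)

_⊆_ : Sides → Sides → Set
K ⊆ S = ∀ X → K ‼ X ≡ true → S ‼ X ≡ true

⊈ᵇ⇒newSide : ∀ K S → (K ⊆ᵇ S) ≡ false → ∃[ X ] (K ‼ X ≡ true × S ‼ X ≡ false)
⊈ᵇ⇒newSide K S K⊈S with incomplete⇒missing (K ⇒ˢ S) K⊈S
... | X , off with K ‼ X in K-on | S ‼ X in S-off | trans (sym (‼-⇒ˢ K S X)) off
...   | true | false | _ = X , K-on , S-off

∨-absorbs : ∀ {x y} → (x ≡ true → y ≡ true) → x ∨ y ≡ y
∨-absorbs {true}  x⇒y = sym (x⇒y refl)
∨-absorbs {false} _   = refl

⊆⇒∪≡ : ∀ {K S} → K ⊆ S → K ∪ S ≡ S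
⊆⇒∪≡ {sides t b l r} {sides t′ b′ l′ r′} K⊆S
  rewrite ∨-absorbs (K⊆S top) | ∨-absorbs (K⊆S bottom) | ∨-absorbs (K⊆S left) | ∨-absorbs (K⊆S right) = refl

isFirst : ∀ {k} → Fin k → Bool
isFirst fzero    = true
isFirst (fsuc _) = false

isLast : ∀ {k} → Fin (suc k) → Bool
isLast {zero}  fzero    = true
isLast {suc k} fzero    = false
isLast {suc k} (fsuc i) = isLast i

isFirst⇒≡0 : ∀ {k} {i : Fin k} → isFirst i ≡ true → toℕ i ≡ 0
isFirst⇒≡0 {i = fzero} _ = refl

¬isFirst⇒0< : ∀ {k} {i : Fin k} → isFirst i ≡ false → 0 < toℕ i
¬isFirst⇒0< {i = fsuc _} _ = s≤s z≤n

isLast⇒≡k : ∀ {k} {i : Fin (suc k)} → isLast i ≡ true → toℕ i ≡ k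
isLast⇒≡k {zero}  {fzero}  _    = refl
isLast⇒≡k {suc k} {fsuc i} last = cong suc (isLast⇒≡k last)

¬isLast⇒<k : ∀ {k} {i : Fin (suc k)} → isLast i ≡ false → toℕ i < k
¬isLast⇒<k {suc k} {fzero}  _        = s≤s z≤n
¬isLast⇒<k {suc k} {fsuc i} ¬last = s≤s (¬isLast⇒<k ¬last)

isLast-fromℕ : ∀ k → isLast (fromℕ k) ≡ true
isLast-fromℕ zero    = refl
isLast-fromℕ (suc k) = isLast-fromℕ k

isFirst-detour : ∀ {k} (x y z : Fin k) → isFirst x ≡ false → isFirst y ≡ false → isFirst z ≡ true →
                 ∣ toℕ x - toℕ y ∣ < ∣ toℕ x - toℕ z ∣ + ∣ toℕ z - toℕ y ∣
isFirst-detour x y z ¬x ¬y z-first rewrite isFirst⇒≡0 {i = z} z-first =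
  o<m⇒o<n⇒∣m-n∣<∣m-o∣+∣o-n∣ (¬isFirst⇒0< {i = x} ¬x) (¬isFirst⇒0< {i = y} ¬y)

isLast-detour : ∀ {k} (x y z : Fin (suc k)) → isLast x ≡ false → isLast y ≡ false → isLast z ≡ true →
                ∣ toℕ x - toℕ y ∣ < ∣ toℕ x - toℕ z ∣ + ∣ toℕ z - toℕ y ∣
isLast-detour x y z ¬x ¬y z-last rewrite isLast⇒≡k {i = z} z-last =
  m<o⇒n<o⇒∣m-n∣<∣m-o∣+∣o-n∣ (¬isLast⇒<k {i = x} ¬x) (¬isLast⇒<k {i = y} ¬y)

isFirst⇒≤ : ∀ {k} (x y : Fin k) → isFirst x ≡ true → toℕ x ≤ toℕ y
isFirst⇒≤ x y x-first = subst (_≤ toℕ y) (sym (isFirst⇒≡0 x-first)) z≤n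

isLast⇒≥ : ∀ {k} (x y : Fin (suc k)) → isLast y ≡ true → toℕ x ≤ toℕ y
isLast⇒≥ x y y-last = subst (toℕ x ≤_) (sym (isLast⇒≡k y-last)) (s≤s⁻¹ (toℕ<n x))

module GridSides (k l : ℕ) where
  open GridGeometry (suc k) (suc l) public

  sidesOf : Vertex → Sides
  sidesOf (i , j) = sides (isFirst i) (isLast i) (isFirst j) (isLast j)

  sidesOfList : List Vertex → Sides
  sidesOfList = foldr (λ v S → sidesOf v ∪ S) none

  offSide-detour : ∀ X {u v z} → sidesOf u ‼ X ≡ false → sidesOf v ‼ X ≡ false → sidesOf z ‼ X ≡ true →
                   dist u v < dist u z + dist z v
  offSide-detour top    {u@(i , _)} {v@(i′ , _)} {z@(i″ , _)} ¬u ¬v z∈X =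
    rowDetour⇒detour u v z (isFirst-detour i i′ i″ ¬u ¬v z∈X)
  offSide-detour bottom {u@(i , _)} {v@(i′ , _)} {z@(i″ , _)} ¬u ¬v z∈X =
    rowDetour⇒detour u v z (isLast-detour i i′ i″ ¬u ¬v z∈X)
  offSide-detour left   {u@(_ , j)} {v@(_ , j′)} {z@(_ , j″)} ¬u ¬v z∈X =
    colDetour⇒detour u v z (isFirst-detour j j′ j″ ¬u ¬v z∈X)
  offSide-detour right  {u@(_ , j)} {v@(_ , j′)} {z@(_ , j″)} ¬u ¬v z∈X =
    colDetour⇒detour u v z (isLast-detour j j′ j″ ¬u ¬v z∈X)

  offSide-convex : ∀ X → Convex (Grid (suc k) (suc l)) (λ w → sidesOf w ‼ X ≡ false)
  offSide-convex X u v z ¬u ¬v geodesic with sidesOf z ‼ X in z-side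
  ... | false = refl
  ... | true  = ⊥-elim (<⇒≱ (offSide-detour X ¬u ¬v z-side) (onGeodesic⇒dist geodesic))

  sidesOfList-∷ : ∀ x P X → sidesOfList (x ∷ P) ‼ X ≡ sidesOf x ‼ X ∨ sidesOfList P ‼ X
  sidesOfList-∷ x P = ‼-∪ (sidesOf x) (sidesOfList P)

  sidesOfList-false : ∀ X {P x} → sidesOfList P ‼ X ≡ false → x ∈ P → sidesOf x ‼ X ≡ false
  sidesOfList-false X {y ∷ P} off (here refl) =
    ∨-conicalˡ _ _ (trans (sym (sidesOfList-∷ y P X)) off)
  sidesOfList-false X {y ∷ P} off (there x∈P) =
    sidesOfList-false X (∨-conicalʳ _ _ (trans (sym (sidesOfList-∷ y P X)) off)) x∈P

  sidesOfList-true : ∀ X P → sidesOfList P ‼ X ≡ true → ∃[ x ] (x ∈ P × sidesOf x ‼ X ≡ true)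
  sidesOfList-true top    [] ()
  sidesOfList-true bottom [] ()
  sidesOfList-true left   [] ()
  sidesOfList-true right  [] ()
  sidesOfList-true X (y ∷ P) on with sidesOf y ‼ X in y-on
  ... | true  = y , here refl , y-on
  ... | false with sidesOfList-true X P
                     (trans (cong (_∨ sidesOfList P ‼ X) (sym y-on)) (trans (sym (sidesOfList-∷ y P X)) on))
  ...   | x , x∈P , x-on = x , there x∈P , x-on

  onSide : Side → Vertex
  onSide top    = fzero , fzero
  onSide bottom = fromℕ k , fzero
  onSide left   = fzero , fzero
  onSide right  = fzero , fromℕ l

  onSide-‼ : ∀ X → sidesOf (onSide X) ‼ X ≡ true
  onSide-‼ top    = refl
  onSide-‼ bottom = isLast-fromℕ k
  onSide-‼ left   = refl
  onSide-‼ right  = isLast-fromℕ l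

  missingSide⇒nonGenerating : ∀ X {P} → sidesOfList P ‼ X ≡ false → ¬ Generating (Grid (suc k) (suc l)) P
  missingSide⇒nonGenerating X off generating with
    generating _ (offSide-convex X) (λ _ → sidesOfList-false X off) (onSide X)
  ... | onSide-off with trans (sym (onSide-‼ X)) onSide-off
  ... | ()

  incomplete⇒nonGenerating : ∀ {P} → complete (sidesOfList P) ≡ false → ¬ Generating (Grid (suc k) (suc l)) P
  incomplete⇒nonGenerating {P} incomplete =
    let X , off = incomplete⇒missing (sidesOfList P) incomplete in missingSide⇒nonGenerating X off

  complete⇒generating : ∀ {P} → complete (sidesOfList P) ≡ true → Generating (Grid (suc k) (suc l)) P
  complete⇒generating {P} all-sides C convex P⊆C (i , j)
    with sidesOfList-true top    P (complete⇒‼ (sidesOfList P) all-sides top)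
       | sidesOfList-true bottom P (complete⇒‼ (sidesOfList P) all-sides bottom)
       | sidesOfList-true left   P (complete⇒‼ (sidesOfList P) all-sides left)
       | sidesOfList-true right  P (complete⇒‼ (sidesOfList P) all-sides right)
  ... | (t₁ , t₂) , t∈P , t-top | (b₁ , b₂) , b∈P , b-bottom
      | (l₁ , l₂) , l∈P , l-left | (r₁ , r₂) , r∈P , r-right =
    convex (i , t₂) (l₁ , j) (i , j) column-point row-point
      (between⇒onGeodesic (i , t₂) (i , j) (l₁ , j)
        (between-leftEnd (toℕ i) (toℕ l₁)) (between-rightEnd (toℕ t₂) (toℕ j)))
    where
    column-point : C (i , t₂)
    column-point = convex (t₁ , t₂) (b₁ , b₂) (i , t₂) (P⊆C _ t∈P) (P⊆C _ b∈P)
      (between⇒onGeodesic (t₁ , t₂) (i , t₂) (b₁ , b₂)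
        (≤-between (isFirst⇒≤ t₁ i t-top) (isLast⇒≥ i b₁ b-bottom))
        (between-leftEnd (toℕ t₂) (toℕ b₂)))

    row-point : C (l₁ , j)
    row-point = convex (l₁ , l₂) (r₁ , r₂) (l₁ , j) (P⊆C _ l∈P) (P⊆C _ r∈P)
      (between⇒onGeodesic (l₁ , l₂) (l₁ , j) (r₁ , r₂)
        (between-leftEnd (toℕ l₁) (toℕ r₁))
        (≤-between (isFirst⇒≤ l₂ j l-left) (isLast⇒≥ j r₂ r-right)))

  nonGenerating⇒incomplete : ∀ {P} → ¬ Generating (Grid (suc k) (suc l)) P → complete (sidesOfList P) ≡ false
  nonGenerating⇒incomplete {P} nonGenerating with complete (sidesOfList P) in all-sides
  ... | false = refl
  ... | true  = ⊥-elim (nonGenerating (complete⇒generating all-sides))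

  position-incomplete : ∀ {r P} → Position (Grid (suc k) (suc l)) r P → complete (sidesOfList P) ≡ false
  position-incomplete pos = nonGenerating⇒incomplete (Position.nonGenerating pos)

  ∈⇒sidesOf-⊆ : ∀ {x P} → x ∈ P → sidesOf x ⊆ sidesOfList P
  ∈⇒sidesOf-⊆ {x} {P} x∈P X x-on with sidesOfList P ‼ X in P-off
  ... | true  = refl
  ... | false with trans (sym x-on) (sidesOfList-false X P-off x∈P)
  ...   | ()

  allVertices : List Vertex
  allVertices = cartesianProduct (allFin (suc k)) (allFin (suc l))

  length-allVertices : length allVertices ≡ suc k * suc l
  length-allVertices = trans (length-cartesianProduct (allFin (suc k)) (allFin (suc l)))
                             (cong₂ _*_ (length-allFin (suc k)) (length-allFin (suc l)))

  ¬Position-allSelected : ∀ {P} → ¬ Position (Grid (suc k) (suc l)) 0 P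
  ¬Position-allSelected {P} pos = <-irrefl (Position.unselected pos) (begin-strict
    length P                  <⟨ n<1+n (length P) ⟩
    length (onSide X ∷ P)     ≤⟨ unique-⊆⇒length-≤ (∷-unique onSide∉P (Position.distinct pos)) ⊆allVertices ⟩
    length allVertices        ≡⟨ length-allVertices ⟩
    suc k * suc l             ∎)
    where
    open ≤-Reasoning
    missingSide : ∃[ X ] (sidesOfList P ‼ X ≡ false)
    missingSide = incomplete⇒missing (sidesOfList P) (position-incomplete pos)
    X : Side
    X = proj₁ missingSide
    onSide∉P : onSide X ∉ P
    onSide∉P ∈P with trans (sym (onSide-‼ X)) (sidesOfList-false X (proj₂ missingSide) ∈P)
    ... | ()
    ⊆allVertices : ∀ {v} → v ∈ onSide X ∷ P → v ∈ allVertices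
    ⊆allVertices {i , j} _ = ∈-cartesianProduct⁺ (∈-allFin i) (∈-allFin j)

  initialPosition : Position (Grid (suc k) (suc l)) (suc k * suc l) []
  initialPosition = record
    { distinct      = []
    ; nonGenerating = incomplete⇒nonGenerating {[]} refl
    ; unselected    = +-identityʳ (suc k * suc l)
    }

-- The nim-value table

record Shape : Set where
  constructor shape
  field
    twoRows : Bool
    parityM : Parity
    parityN : Parity

fromParity : Parity → ℕ
fromParity 0ℙ = 0
fromParity 1ℙ = 1

unmet : Bool → ℕ
unmet true  = 0
unmet false = 1

toggle : ℕ → ℕ
toggle zero          = 1
toggle (suc zero)    = 0
toggle (suc (suc n)) = suc (suc (toggle n))

balance : Shape → ℕ → ℕ → ℕ
balance (shape twoRows pm pn) h v with compare h v
... | less _ _    = fromParity pm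
... | greater _ _ = fromParity pn
... | equal 2     = if twoRows then 0 else 2
... | equal _     = 2

-- Nim-number of a position that meets the sides S and has an even number of selected vertices;
-- `balance` compares the numbers of unmet sides among top/bottom and among left/right.
grundy : Shape → Sides → ℕ
grundy sh@(shape _ pm pn) (sides t b l r) with pm +ᵖ pn
... | 0ℙ = 0
... | 1ℙ = balance sh (unmet t + unmet b) (unmet l + unmet r)

value : Shape → Sides → Parity → ℕ
value sh S 0ℙ = grundy sh S
value sh S 1ℙ = toggle (grundy sh S)

segmentParity : Parity → Bool → Bool → Parity
segmentParity p true  true  = p
segmentParity p true  false = p ⁻¹
segmentParity p false true  = p ⁻¹
segmentParity p false false = p

regionParity : Shape → Sides → Parity
regionParity (shape _ pm pn) (sides t b l r) = segmentParity pm t b *ᵖ segmentParity pn l r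

-- The side sets of actual vertices: no vertex lies on two opposite sides, and if m = 2 every vertex
-- lies on the top or the bottom row.
validRows : Bool → Bool → Bool → Bool
validRows twoRows t b = not (t ∧ b) ∧ (t ∨ b ∨ not twoRows)

valid : Shape → Sides → Bool
valid sh (sides t b l r) = validRows (Shape.twoRows sh) t b ∧ not (l ∧ r)

∀ᵇ : (Bool → Bool) → Bool
∀ᵇ f = f true ∧ f false

∃ᵇ : (Bool → Bool) → Bool
∃ᵇ f = f true ∨ f false

∀ᵖ : (Parity → Bool) → Bool
∀ᵖ f = f 0ℙ ∧ f 1ℙ

∀ˢ : (Sides → Bool) → Bool
∀ˢ f = ∀ᵇ λ t → ∀ᵇ λ b → ∀ᵇ λ l → ∀ᵇ λ r → f (sides t b l r)

∃ˢ : (Sides → Bool) → Bool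
∃ˢ f = ∃ᵇ λ t → ∃ᵇ λ b → ∃ᵇ λ l → ∃ᵇ λ r → f (sides t b l r)

∀ᵍ : (Shape → Bool) → Bool
∀ᵍ f = ∀ᵇ λ two → ∀ᵖ λ pm → ∀ᵖ λ pn → f (shape two pm pn)

∀< : ℕ → (ℕ → Bool) → Bool
∀< zero    f = true
∀< (suc n) f = ∀< n f ∧ f n

_≡ᵖ_ : Parity → Parity → Bool
0ℙ ≡ᵖ 0ℙ = true
1ℙ ≡ᵖ 1ℙ = true
_  ≡ᵖ _  = false

freshMove? : Shape → Sides → Parity → ℕ → Sides → Bool
freshMove? sh S p j K =
  valid sh K ∧ not (K ⊆ᵇ S) ∧ not (complete (K ∪ S)) ∧ (value sh (K ∪ S) (p ⁻¹) ≡ᵇ j)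

stayMove? : Shape → Sides → Parity → ℕ → Bool
stayMove? sh S p j = not (regionParity sh S ≡ᵖ p) ∧ (value sh S (p ⁻¹) ≡ᵇ j)

reachable? : Shape → Sides → Parity → ℕ → Bool
reachable? sh S p j = ∃ˢ (freshMove? sh S p j) ∨ stayMove? sh S p j

reachCheck : Shape → Sides → Parity → Bool
reachCheck sh S p = complete S ∨ ∀< (value sh S p) (reachable? sh S p)

escapeCheck : Shape → Sides → Parity → Sides → Bool
escapeCheck sh S p K = not (valid sh K) ∨ complete (K ∪ S) ∨ not (value sh (K ∪ S) (p ⁻¹) ≡ᵇ value sh S p)

-- m = 2 forces m even.
consistent : Shape → Bool
consistent (shape twoRows pm _) = not twoRows ∨ (pm ≡ᵖ 0ℙ)

∀ᵇ-elim : ∀ f → T (∀ᵇ f) → ∀ b → T (f b)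
∀ᵇ-elim f h true  = proj₁ (Equivalence.to T-∧ h)
∀ᵇ-elim f h false = proj₂ (Equivalence.to T-∧ h)

∃ᵇ-elim : ∀ f → T (∃ᵇ f) → ∃[ b ] T (f b)
∃ᵇ-elim f h with Equivalence.to (T-∨ {f true}) h
... | inj₁ holds = true , holds
... | inj₂ holds = false , holds

∀ᵖ-elim : ∀ f → T (∀ᵖ f) → ∀ p → T (f p)
∀ᵖ-elim f h 0ℙ = proj₁ (Equivalence.to T-∧ h)
∀ᵖ-elim f h 1ℙ = proj₂ (Equivalence.to T-∧ h)

∀ˢ-elim : ∀ f → T (∀ˢ f) → ∀ S → T (f S)
∀ˢ-elim f h (sides t b l r) =
  ∀ᵇ-elim (λ r → f (sides t b l r)) (
  ∀ᵇ-elim (λ l → ∀ᵇ λ r → f (sides t b l r)) (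
  ∀ᵇ-elim (λ b → ∀ᵇ λ l → ∀ᵇ λ r → f (sides t b l r)) (
  ∀ᵇ-elim (λ t → ∀ᵇ λ b → ∀ᵇ λ l → ∀ᵇ λ r → f (sides t b l r)) h t) b) l) r

∃ˢ-elim : ∀ f → T (∃ˢ f) → ∃[ S ] T (f S)
∃ˢ-elim f h =
  let t , h₁ = ∃ᵇ-elim (λ t → ∃ᵇ λ b → ∃ᵇ λ l → ∃ᵇ λ r → f (sides t b l r)) h
      b , h₂ = ∃ᵇ-elim (λ b → ∃ᵇ λ l → ∃ᵇ λ r → f (sides t b l r)) h₁
      l , h₃ = ∃ᵇ-elim (λ l → ∃ᵇ λ r → f (sides t b l r)) h₂
      r , h₄ = ∃ᵇ-elim (λ r → f (sides t b l r)) h₃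
  in sides t b l r , h₄

∀ᵍ-elim : ∀ f → T (∀ᵍ f) → ∀ sh → T (f sh)
∀ᵍ-elim f h (shape two pm pn) =
  ∀ᵖ-elim (λ pn → f (shape two pm pn)) (
  ∀ᵖ-elim (λ pm → ∀ᵖ λ pn → f (shape two pm pn)) (
  ∀ᵇ-elim (λ two → ∀ᵖ λ pm → ∀ᵖ λ pn → f (shape two pm pn)) h two) pm) pn

∀<-elim : ∀ {n} f → T (∀< n f) → ∀ {j} → j < n → T (f j)
∀<-elim {suc n} f h {j} j<1+n with m≤n⇒m<n∨m≡n (s≤s⁻¹ j<1+n)
... | inj₁ j<n  = ∀<-elim f (proj₁ (Equivalence.to T-∧ h)) j<n
... | inj₂ refl = proj₂ (Equivalence.to (T-∧ {∀< n f}) h)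

T-not-≡ᵇ : ∀ {m n} → T (not (m ≡ᵇ n)) → m ≢ n
T-not-≡ᵇ {m} h refl = subst T (Equivalence.to T-not-≡ h) (≡⇒≡ᵇ m m refl)

T-not-≡ᵖ : ∀ {p q} → T (not (p ≡ᵖ q)) → p ≢ q
T-not-≡ᵖ {0ℙ} () refl
T-not-≡ᵖ {1ℙ} () refl

T-∨-false : ∀ {x y} → x ≡ false → T (x ∨ y) → T y
T-∨-false refl h = h

record FreshMove (sh : Shape) (S : Sides) (p : Parity) (j : ℕ) (K : Sides) : Set where
  field
    valid-move : valid sh K ≡ true
    new-side   : (K ⊆ᵇ S) ≡ false
    incomplete : complete (K ∪ S) ≡ false
    value-move : value sh (K ∪ S) (p ⁻¹) ≡ j

record StayMove (sh : Shape) (S : Sides) (p : Parity) (j : ℕ) : Set where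
  field
    room       : regionParity sh S ≢ p
    value-move : value sh S (p ⁻¹) ≡ j

freshMove-sound : ∀ {sh S p j} K → T (freshMove? sh S p j K) → FreshMove sh S p j K
freshMove-sound K h =
  let valid-K , h₁ = Equivalence.to T-∧ h
      new , h₂     = Equivalence.to T-∧ h₁
      inc , val    = Equivalence.to T-∧ h₂
  in
  record { valid-move = Equivalence.to T-≡ valid-K ; new-side = Equivalence.to T-not-≡ new
         ; incomplete = Equivalence.to T-not-≡ inc ; value-move = ≡ᵇ⇒≡ _ _ val }

stayMove-sound : ∀ {sh S p j} → T (stayMove? sh S p j) → StayMove sh S p j
stayMove-sound h = let room , val = Equivalence.to T-∧ h in
  record { room = T-not-≡ᵖ room ; value-move = ≡ᵇ⇒≡ _ _ val }

-- Both hold by evaluation: each Boolean normalises to true.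
reachTable : T (∀ᵍ λ sh → not (consistent sh) ∨ ∀ˢ λ S → ∀ᵖ (reachCheck sh S))
reachTable = _

escapeTable : T (∀ᵍ λ sh → not (consistent sh) ∨ ∀ˢ λ S → ∀ᵖ λ p → ∀ˢ (escapeCheck sh S p))
escapeTable = _

reachCheck-holds : ∀ {sh} → consistent sh ≡ true → ∀ S p → T (reachCheck sh S p)
reachCheck-holds {sh} ok S = ∀ᵖ-elim (reachCheck sh S) (∀ˢ-elim (λ S → ∀ᵖ (reachCheck sh S)) table S)
  where
  table : T (∀ˢ λ S → ∀ᵖ (reachCheck sh S))
  table = T-∨-false (cong not ok)
    (∀ᵍ-elim (λ sh → not (consistent sh) ∨ ∀ˢ λ S → ∀ᵖ (reachCheck sh S)) reachTable sh)

escapeCheck-holds : ∀ {sh} → consistent sh ≡ true → ∀ S p K → T (escapeCheck sh S p K)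
escapeCheck-holds {sh} ok S p = ∀ˢ-elim (escapeCheck sh S p)
  (∀ᵖ-elim (λ p → ∀ˢ (escapeCheck sh S p)) (∀ˢ-elim (λ S → ∀ᵖ λ p → ∀ˢ (escapeCheck sh S p)) table S) p)
  where
  table : T (∀ˢ λ S → ∀ᵖ λ p → ∀ˢ (escapeCheck sh S p))
  table = T-∨-false (cong not ok)
    (∀ᵍ-elim (λ sh → not (consistent sh) ∨ ∀ˢ λ S → ∀ᵖ λ p → ∀ˢ (escapeCheck sh S p)) escapeTable sh)

reach-certified : ∀ {sh} → consistent sh ≡ true → ∀ {S} → complete S ≡ false → ∀ p {j} → j < value sh S p →
                  (∃[ K ] FreshMove sh S p j K) ⊎ StayMove sh S p j
reach-certified {sh} ok {S} incomplete p {j} j<value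
  with Equivalence.to T-∨ (∀<-elim (reachable? sh S p) (T-∨-false incomplete (reachCheck-holds ok S p)) j<value)
... | inj₁ fresh = let K , h = ∃ˢ-elim (freshMove? sh S p j) fresh in inj₁ (K , freshMove-sound K h)
... | inj₂ stay  = inj₂ (stayMove-sound stay)

escape-certified : ∀ {sh} → consistent sh ≡ true → ∀ S p K → valid sh K ≡ true → complete (K ∪ S) ≡ false →
                   value sh (K ∪ S) (p ⁻¹) ≢ value sh S p
escape-certified ok S p K valid-K incomplete =
  T-not-≡ᵇ (T-∨-false incomplete (T-∨-false (cong not valid-K) (escapeCheck-holds ok S p K)))

-- Grids with at least two rows and three columns

isLast-inject₁ : ∀ {k} (i : Fin k) → isLast (inject₁ i) ≡ false
isLast-inject₁ {suc k} fzero    = refl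
isLast-inject₁ {suc k} (fsuc i) = isLast-inject₁ i

¬isLast⇒inject₁ : ∀ {k} (i : Fin (suc k)) → isLast i ≡ false → ∃[ i′ ] (i ≡ inject₁ i′)
¬isLast⇒inject₁ {zero}  fzero    ()
¬isLast⇒inject₁ {suc k} fzero    _     = fzero , refl
¬isLast⇒inject₁ {suc k} (fsuc i) ¬last =
  let i′ , i≡i′ = ¬isLast⇒inject₁ i ¬last in fsuc i′ , cong fsuc i≡i′

segment : ∀ k → Bool → Bool → List (Fin (suc (suc k)))
segment k true  true  = allFin (suc (suc k))
segment k true  false = map inject₁ (allFin (suc k))
segment k false true  = map fsuc (allFin (suc k))
segment k false false = map (fsuc ∘ inject₁) (allFin k)

∈-segment⁻ : ∀ {k t b} {i : Fin (suc (suc k))} → i ∈ segment k t b →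
             (isFirst i ≡ true → t ≡ true) × (isLast i ≡ true → b ≡ true)
∈-segment⁻ {t = true} {true} _ = (λ _ → refl) , (λ _ → refl)
∈-segment⁻ {t = true} {false} i∈ with ∈-map⁻ inject₁ i∈
... | i′ , _ , refl = (λ _ → refl) , λ last → trans (sym (isLast-inject₁ i′)) last
∈-segment⁻ {t = false} {true} i∈ with ∈-map⁻ fsuc i∈
... | _ , _ , refl = (λ ()) , (λ _ → refl)
∈-segment⁻ {t = false} {false} i∈ with ∈-map⁻ (fsuc ∘ inject₁) i∈
... | i′ , _ , refl = (λ ()) , λ last → trans (sym (isLast-inject₁ i′)) last

∈-segment⁺ : ∀ {k t b} (i : Fin (suc (suc k))) →
             (isFirst i ≡ true → t ≡ true) → (isLast i ≡ true → b ≡ true) → i ∈ segment k t b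
∈-segment⁺ {t = true}  {true}  i        _     _ = ∈-allFin i
∈-segment⁺ {t = false} {true}  fzero    first _ with first refl
... | ()
∈-segment⁺ {t = false} {true}  (fsuc i) _     _ = ∈-map⁺ fsuc (∈-allFin i)
∈-segment⁺ {t = true}  {false} i        _     last with isLast i in i-last
... | true with last refl
...   | ()
∈-segment⁺ {t = true}  {false} i        _     last | false with ¬isLast⇒inject₁ i i-last
...   | i′ , refl = ∈-map⁺ inject₁ (∈-allFin i′)
∈-segment⁺ {t = false} {false} fzero    first _ with first refl
... | ()
∈-segment⁺ {t = false} {false} (fsuc i) _     last with isLast i in i-last
... | true with last refl
...   | ()
∈-segment⁺ {t = false} {false} (fsuc i) _     last | false with ¬isLast⇒inject₁ i i-last
...   | i′ , refl = ∈-map⁺ (fsuc ∘ inject₁) (∈-allFin i′)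

segment-unique : ∀ k t b → Unique (segment k t b)
segment-unique k true  true  = Unique.allFin⁺ _
segment-unique k true  false = Unique.map⁺ inject₁-injective (Unique.allFin⁺ _)
segment-unique k false true  = Unique.map⁺ fsuc-injective (Unique.allFin⁺ _)
segment-unique k false false = Unique.map⁺ (inject₁-injective ∘ fsuc-injective) (Unique.allFin⁺ _)

parity-suc : ∀ n → parity (suc n) ≡ parity n ⁻¹
parity-suc n = sym (ℙ.suc-homo-⁻¹ (suc n))

parity-length-map-allFin : ∀ {A : Set} n (f : Fin n → A) → parity (length (map f (allFin n))) ≡ parity n
parity-length-map-allFin n f = cong parity (trans (length-map f (allFin n)) (length-allFin n))

parity-length-segment : ∀ k t b → parity (length (segment k t b)) ≡ segmentParity (parity k) t b
parity-length-segment k true  true  = cong parity (length-allFin (suc (suc k)))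
parity-length-segment k true  false = trans (parity-length-map-allFin (suc k) inject₁) (parity-suc k)
parity-length-segment k false true  = trans (parity-length-map-allFin (suc k) fsuc) (parity-suc k)
parity-length-segment k false false = parity-length-map-allFin k (fsuc ∘ inject₁)

indexMeeting : ∀ {k} → Bool → Bool → Fin (suc (suc k))
indexMeeting true  _     = fzero
indexMeeting false true  = fromℕ _
indexMeeting false false = fsuc fzero

indexMeeting-sides : ∀ k t b → validRows (k ≡ᵇ 0) t b ≡ true →
                     isFirst (indexMeeting {k} t b) ≡ t × isLast (indexMeeting {k} t b) ≡ b
indexMeeting-sides k       true  false _ = refl , refl
indexMeeting-sides k       false true  _ = refl , isLast-fromℕ (suc k)
indexMeeting-sides (suc k) false false _ = refl , refl

validRows-sides : ∀ k (i : Fin (suc (suc k))) → validRows (k ≡ᵇ 0) (isFirst i) (isLast i) ≡ true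
validRows-sides k       fzero        = refl
validRows-sides zero    (fsuc fzero) = refl
validRows-sides (suc k) (fsuc i)     = ∨-zeroʳ (isLast i)

validRows-wide : ∀ t b → not (t ∧ b) ≡ true → validRows false t b ≡ true
validRows-wide t b t≢b = cong₂ _∧_ t≢b (trans (cong (t ∨_) (∨-zeroʳ b)) (∨-zeroʳ t))

¬isFirst∧isLast : ∀ {k} (i : Fin (suc (suc k))) → not (isFirst i ∧ isLast i) ≡ true
¬isFirst∧isLast fzero    = refl
¬isFirst∧isLast (fsuc _) = refl

gridShape : ℕ → ℕ → Shape
gridShape a c = shape (a ≡ᵇ 0) (parity (2 + a)) (parity (3 + c))

gridShape-consistent : ∀ a c → consistent (gridShape a c) ≡ true
gridShape-consistent zero    c = refl
gridShape-consistent (suc a) c = refl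

module GridGame (a c : ℕ) where
  open GridSides (suc a) (suc (suc c)) public

  vertexMeeting : Sides → Vertex
  vertexMeeting (sides t b l r) = indexMeeting t b , indexMeeting l r

  sidesOf-vertexMeeting : ∀ K → valid (gridShape a c) K ≡ true → sidesOf (vertexMeeting K) ≡ K
  sidesOf-vertexMeeting (sides t b l r) valid-K
    with indexMeeting-sides a t b (∧-conicalˡ _ _ valid-K)
       | indexMeeting-sides (suc c) l r (validRows-wide l r (∧-conicalʳ _ _ valid-K))
  ... | t≡ , b≡ | l≡ , r≡ rewrite t≡ | b≡ | l≡ | r≡ = refl

  valid-sidesOf : ∀ v → valid (gridShape a c) (sidesOf v) ≡ true
  valid-sidesOf (i , j) = cong₂ _∧_ (validRows-sides a i) (¬isFirst∧isLast j)

  region : Sides → List Vertex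
  region S = cartesianProduct (segment a (S ‼ top) (S ‼ bottom)) (segment (suc c) (S ‼ left) (S ‼ right))

  region-unique : ∀ S → Unique (region S)
  region-unique S = Unique.cartesianProduct⁺
    (segment-unique a (S ‼ top) (S ‼ bottom)) (segment-unique (suc c) (S ‼ left) (S ‼ right))

  parity-length-region : ∀ S → parity (length (region S)) ≡ regionParity (gridShape a c) S
  parity-length-region S = begin
    parity (length (region S))                   ≡⟨ cong parity (length-cartesianProduct rows cols) ⟩
    parity (length rows * length cols)           ≡⟨ ℙ.*-homo-* (length rows) (length cols) ⟩
    parity (length rows) *ᵖ parity (length cols) ≡⟨ cong₂ _*ᵖ_ (parity-length-segment a (S ‼ top) (S ‼ bottom))
                                                               (parity-length-segment (suc c) (S ‼ left) (S ‼ right)) ⟩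
    regionParity (gridShape a c) S               ∎
    where
    open ≡-Reasoning
    rows : List (Fin (suc (suc a)))
    rows = segment a (S ‼ top) (S ‼ bottom)
    cols : List (Fin (suc (suc (suc c))))
    cols = segment (suc c) (S ‼ left) (S ‼ right)

  ∈-region⁺ : ∀ {S} v → sidesOf v ⊆ S → v ∈ region S
  ∈-region⁺ (i , j) v⊆S =
    ∈-cartesianProduct⁺ (∈-segment⁺ i (v⊆S top) (v⊆S bottom)) (∈-segment⁺ j (v⊆S left) (v⊆S right))

  ∈-region⁻ : ∀ {S v} → v ∈ region S → sidesOf v ⊆ S
  ∈-region⁻ {S} v∈
    with ∈-cartesianProduct⁻ (segment a (S ‼ top) (S ‼ bottom)) (segment (suc c) (S ‼ left) (S ‼ right)) v∈
  ... | i∈ , j∈ with ∈-segment⁻ i∈ | ∈-segment⁻ j∈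
  ...   | first , last | first′ , last′ = λ { top → first ; bottom → last ; left → first′ ; right → last′ }

  label : List Vertex → ℕ
  label P = value (gridShape a c) (sidesOfList P) (parity (length P))

  label-∷ : ∀ v P → label (v ∷ P) ≡ value (gridShape a c) (sidesOf v ∪ sidesOfList P) (parity (length P) ⁻¹)
  label-∷ v P = cong (value (gridShape a c) (sidesOf v ∪ sidesOfList P)) (parity-suc (length P))

  move-to : ∀ {P v S j} → v ∉ P → sidesOfList (v ∷ P) ≡ S → complete S ≡ false →
            value (gridShape a c) S (parity (length P) ⁻¹) ≡ j →
            ∃[ w ] (Move (Grid (2 + a) (3 + c)) P w × label (w ∷ P) ≡ j)
  move-to {P} {v} v∉P refl incomplete value-j =
    v , (v∉P , incomplete⇒nonGenerating incomplete) , trans (label-∷ v P) value-j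

  freshMove⇒move : ∀ {P j K} → FreshMove (gridShape a c) (sidesOfList P) (parity (length P)) j K →
                   ∃[ v ] (Move (Grid (2 + a) (3 + c)) P v × label (v ∷ P) ≡ j)
  freshMove⇒move {P} {j} {K} fresh =
    move-to v∉P (cong (_∪ sidesOfList P) sides-v) incomplete value-move
    where
    open FreshMove fresh
    sides-v : sidesOf (vertexMeeting K) ≡ K
    sides-v = sidesOf-vertexMeeting K valid-move

    v∉P : vertexMeeting K ∉ P
    v∉P v∈P with ⊈ᵇ⇒newSide K (sidesOfList P) new-side
    ... | X , K-on , P-off
      with trans (sym (∈⇒sidesOf-⊆ v∈P X (subst (λ S → S ‼ X ≡ true) (sym sides-v) K-on))) P-off
    ...   | ()

  stayMove⇒move : ∀ {r P j} → Position (Grid (2 + a) (3 + c)) r P →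
                  StayMove (gridShape a c) (sidesOfList P) (parity (length P)) j →
                  ∃[ v ] (Move (Grid (2 + a) (3 + c)) P v × label (v ∷ P) ≡ j)
  stayMove⇒move {P = P} pos stay =
    move-to (proj₂ (proj₂ free)) (⊆⇒∪≡ (∈-region⁻ (proj₁ (proj₂ free))))
            (position-incomplete pos) value-move
    where
    open StayMove stay
    length-≢ : length P ≢ length (region (sidesOfList P))
    length-≢ eq = room (trans (sym (parity-length-region (sidesOfList P))) (cong parity (sym eq)))

    shorter : length P < length (region (sidesOfList P))
    shorter = ≤∧≢⇒< (unique-⊆⇒length-≤ (Position.distinct pos) λ {x} x∈P → ∈-region⁺ x (∈⇒sidesOf-⊆ x∈P))
                    length-≢

    free : ∃[ v ] (v ∈ region (sidesOfList P) × v ∉ P)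
    free = longer⇒∃∉ (≡-dec Fin._≟_ Fin._≟_) (region-unique (sidesOfList P)) shorter

  labelling : MexLabelling (Grid (2 + a) (3 + c)) label
  labelling = record
    { terminal = λ pos → ⊥-elim (¬Position-allSelected pos)
    ; reach    = reach
    ; escape   = escape
    }
    where
    reach : ∀ {r P} → Position (Grid (2 + a) (3 + c)) (suc r) P → ∀ j → j < label P →
            ∃[ v ] (Move (Grid (2 + a) (3 + c)) P v × label (v ∷ P) ≡ j)
    reach {P = P} pos j j<label
      with reach-certified (gridShape-consistent a c) (position-incomplete pos) (parity (length P)) j<label
    ... | inj₁ (_ , fresh) = freshMove⇒move fresh
    ... | inj₂ stay        = stayMove⇒move pos stay

    escape : ∀ {r P v} → Position (Grid (2 + a) (3 + c)) (suc r) P → Move (Grid (2 + a) (3 + c)) P v →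
             label (v ∷ P) ≢ label P
    escape {P = P} {v} _ (_ , nonGenerating) same =
      escape-certified (gridShape-consistent a c) (sidesOfList P) (parity (length P)) (sidesOf v) (valid-sidesOf v)
        (nonGenerating⇒incomplete nonGenerating) (trans (sym (label-∷ v P)) same)

  nimDNG-grid : NimDNG (Grid (2 + a) (3 + c)) (grundy (gridShape a c) none)
  nimDNG-grid = nimAt-labelling labelling _ initialPosition

%2≡fromParity : ∀ n → n % 2 ≡ fromParity (parity n)
%2≡fromParity zero          = refl
%2≡fromParity (suc zero)    = refl
%2≡fromParity (suc (suc n)) = %2≡fromParity n

grundy-start-twoRows : ∀ c → grundy (gridShape 0 c) none ≡ 0
grundy-start-twoRows c with parity (3 + c)
... | 0ℙ = refl
... | 1ℙ = refl

grundy-start : ∀ a c → grundy (gridShape (suc a) c) none ≡ 2 * ((3 + a + (3 + c)) % 2)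
grundy-start a c = begin
  grundy (gridShape (suc a) c) none
    ≡⟨ by-parities (parity (3 + a)) (parity (3 + c)) ⟩
  2 * fromParity (parity (3 + a) +ᵖ parity (3 + c))
    ≡⟨ cong (λ p → 2 * fromParity p) (ℙ.+-homo-+ (3 + a) (3 + c)) ⟨
  2 * fromParity (parity (3 + a + (3 + c)))
    ≡⟨ cong (2 *_) (%2≡fromParity (3 + a + (3 + c))) ⟨
  2 * ((3 + a + (3 + c)) % 2)
    ∎
  where
  open ≡-Reasoning
  by-parities : ∀ pm pn → grundy (shape false pm pn) none ≡ 2 * fromParity (pm +ᵖ pn)
  by-parities 0ℙ 0ℙ = refl
  by-parities 0ℙ 1ℙ = refl
  by-parities 1ℙ 0ℙ = refl
  by-parities 1ℙ 1ℙ = refl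

proposition7p14 : ∀ (m n : ℕ) → 2 ≤ m → m ≤ n → 3 ≤ n →
    (m ≡ 2 → NimDNG (Grid m n) 0) ×
    (3 ≤ m → NimDNG (Grid m n) (2 * ((m + n) % 2)))
proposition7p14 (suc (suc a)) (suc (suc (suc c))) (s≤s (s≤s _)) _ (s≤s (s≤s (s≤s _))) = twoRows , moreRows
  where
  twoRows : 2 + a ≡ 2 → NimDNG (Grid (2 + a) (3 + c)) 0
  twoRows refl = subst (NimDNG (Grid 2 (3 + c))) (grundy-start-twoRows c) (GridGame.nimDNG-grid 0 c)

  moreRows : 3 ≤ 2 + a → NimDNG (Grid (2 + a) (3 + c)) (2 * ((2 + a + (3 + c)) % 2))
  moreRows (s≤s (s≤s (s≤s {n = b} _))) =
    subst (NimDNG (Grid (3 + b) (3 + c))) (grundy-start b c) (GridGame.nimDNG-grid (suc b) c)
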